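{- For every finite multiset $G$ of I/O pairs and every pair $(B,Y)$: the I/O sequent $G\vdash(B,Y)$ is derivable in the calculus $\mathbf{C}_4$ if and only if $G\vdash_{OUT_4^+}(B,Y)$.
   Context: Formulas are classical propositional formulas built with $\top,\bot,\neg,\wedge,\vee,\to$; $\models$ denotes classical semantic entailment. An I/O pair is an ordered pair $(A,X)$ of formulas. Rules on pairs: (TOP) $(\top,\top)$ is derivable from no premises; (BOT) $(\bot,\bot)$ is derivable from no premises; (WO) from $(A,X)$ derive $(A,Y)$ whenever $X\models Y$; (SI) from $(A,X)$ derive $(B,X)$ whenever $B\models A$; (AND) from $(A,X_1)$ and $(A,X_2)$ derive $(A,X_1\wedge X_2)$; (OR) from $(A_1,X)$ and $(A_2,X)$ derive $(A_1\vee A_2,X)$; (CT) from $(A,X)$ and $(A\wedge X,Y)$ derive $(A,Y)$. The logic $OUT_4^+$ consists of TOP, BOT, WO, SI, AND, OR, CT. $G\vdash_{OUT_4^+}(B,Y)$ means there is a finite tree with root $(B,Y)$, each leaf an element of $G$ or an axiom (TOP or BOT), and each non-leaf node obtained from its children by one of these rules. An LK sequent $\Gamma\Rightarrow\Delta$ is derivable in LK iff $\bigwedge\Gamma\models\bigvee\Delta$ (empty conjunction $=\top$, empty disjunction $=\bot$). An I/O sequent has the form $G\vdash(B,Y)$ with $G$ a finite multiset of pairs. The calculus $\mathbf{C}_4$ has the rules: (IN) from $B\Rightarrow$ infer $G\vdash(B,Y)$; (OUT) from $\Rightarrow Y$ infer $G\vdash(B,Y)$; (E4) from $G\vdash(B\wedge\neg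 A,Y)$ and $G\vdash(B\wedge X,Y\vee\neg X)$ infer $(A,X),G\vdash(B,Y)$. An I/O sequent is derivable in $\mathbf{C}_4$ if it is the root of a finite tree built with these rules in which every LK-sequent premise is derivable in LK. -}

module Defs where

open import Data.Nat using (ℕ)
open import Data.Bool using (Bool; true; false; not; _∧_; _∨_)
open import Data.Product using (_×_; _,_)
open import Data.List using (List; _∷_; [])
open import Data.List.Membership.Propositional using (_∈_)
open import Data.List.Relation.Binary.Permutation.Propositional using (_↭_)
open import Relation.Binary.PropositionalEquality using (_≡_)

data Fm : Set where
  atom : ℕ → Fm
  ⊤f ⊥f : Fm
  ¬f_ : Fm → Fm
  _∧f_ _∨f_ _→f_ : Fm → Fm → Fm

infixr 6 _∧f_
infixr 5 _∨f_
infixr 4 _→f_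
infix 7 ¬f_

Valuation : Set
Valuation = ℕ → Bool

⟦_⟧ : Fm → Valuation → Bool
⟦ atom n ⟧ v = v n
⟦ ⊤f ⟧ v = true
⟦ ⊥f ⟧ v = false
⟦ ¬f A ⟧ v = not (⟦ A ⟧ v)
⟦ A ∧f B ⟧ v = ⟦ A ⟧ v ∧ ⟦ B ⟧ v
⟦ A ∨f B ⟧ v = ⟦ A ⟧ v ∨ ⟦ B ⟧ v
⟦ A →f B ⟧ v = not (⟦ A ⟧ v) ∨ ⟦ B ⟧ v

infix 3 _⊨_
_⊨_ : Fm → Fm → Set
A ⊨ B = (v : Valuation) → ⟦ A ⟧ v ≡ true → ⟦ B ⟧ v ≡ true

Pair : Set
Pair = Fm × Fm

data _⊢OUT4⁺_ (G : List Pair) : Pair → Set where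
  leaf : ∀ {p} → p ∈ G → G ⊢OUT4⁺ p
  TOP  : G ⊢OUT4⁺ (⊤f , ⊤f)
  BOT  : G ⊢OUT4⁺ (⊥f , ⊥f)
  WO   : ∀ {A X Y} → G ⊢OUT4⁺ (A , X) → X ⊨ Y → G ⊢OUT4⁺ (A , Y)
  SI   : ∀ {A B X} → G ⊢OUT4⁺ (A , X) → B ⊨ A → G ⊢OUT4⁺ (B , X)
  AND  : ∀ {A X₁ X₂} → G ⊢OUT4⁺ (A , X₁) → G ⊢OUT4⁺ (A , X₂)
       → G ⊢OUT4⁺ (A , X₁ ∧f X₂)
  OR   : ∀ {A₁ A₂ X} → G ⊢OUT4⁺ (A₁ , X) → G ⊢OUT4⁺ (A₂ , X)
       → G ⊢OUT4⁺ (A₁ ∨f A₂ , X)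
  CT   : ∀ {A X Y} → G ⊢OUT4⁺ (A , X) → G ⊢OUT4⁺ (A ∧f X , Y)
       → G ⊢OUT4⁺ (A , Y)

-- LK-derivability of the sequents B ⇒ (empty succedent) and ⇒ Y,
-- via the stated characterization: Γ ⇒ Δ derivable iff ⋀Γ ⊨ ⋁Δ.
LK-in : Fm → Set
LK-in B = B ⊨ ⊥f

LK-out : Fm → Set
LK-out Y = ⊤f ⊨ Y

-- The calculus C₄ on I/O sequents G ⊢ (B,Y); G is a multiset, represented
-- as a list taken up to permutation (the principal pair of E4 may be anywhere).
data C4 : List Pair → Pair → Set where
  IN  : ∀ {G B Y} → LK-in B → C4 G (B , Y)
  OUT : ∀ {G B Y} → LK-out Y → C4 G (B , Y)
  E4  : ∀ {G G' A X B Y}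
      → C4 G (B ∧f ¬f A , Y)
      → C4 G (B ∧f X , Y ∨f ¬f X)
      → G' ↭ ((A , X) ∷ G)
      → C4 G' (B , Y)

-- Soundness: every E4 step is a derived rule of OUT₄⁺. Split B into B ∧ ¬A and
-- B ∧ A (OR); on the second half the pair (A, X) together with CT turns the
-- right premise into (B ∧ A, (Y ∨ ¬X) ∧ X), which entails Y.
--
-- Completeness: E4 is invertible with respect to every pair of G, so a C₄-proof
-- of the first premise of AND, OR or CT can be pushed through the inverted
-- proof of the second premise; together with weakening/strengthening (WO, SI)
-- this shows that C₄-derivability is closed under all rules of OUT₄⁺. A pair
-- (A, X) ∈ G is derived by one E4 step with the premises A ∧ ¬A ⇒ and ⇒ X ∨ ¬X.

module Submission where

open import Defs
open import Data.Bool using (true; false; not; _∧_; _∨_)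
open import Data.Bool.Properties using (∧-conicalˡ; ∧-conicalʳ; ∨-zeroʳ)
open import Data.List using (List; _∷_; _++_)
open import Data.List.Membership.Propositional using (_∈_)
open import Data.List.Membership.Propositional.Properties using (∈-∃++)
open import Data.List.Relation.Binary.Permutation.Propositional
  using (_↭_; ↭-refl; ↭-sym; ↭-trans; prep; swap)
open import Data.List.Relation.Binary.Permutation.Propositional.Properties
  using (∈-resp-↭; drop-∷; shift)
open import Data.List.Relation.Binary.Subset.Propositional using (_⊆_)
open import Data.List.Relation.Unary.Any using (here; there)
open import Data.Product using (_,_; _×_; ∃-syntax)
open import Data.Sum using (_⊎_; inj₁; inj₂)
open import Function.Bundles using (_⇔_; mk⇔)
open import Relation.Binary.PropositionalEquality using (_≡_; refl)

↭-∷-cases : ∀ {a} {A : Set a} {x y : A} {xs ys zs : List A} →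
            zs ↭ x ∷ xs → zs ↭ y ∷ ys →
            (x ≡ y × xs ↭ ys) ⊎ ∃[ ws ] (xs ↭ y ∷ ws × ys ↭ x ∷ ws)
↭-∷-cases {x = x} {y} p q with ∈-resp-↭ σ (here refl)
  where σ = ↭-trans (↭-sym q) p
... | here refl = inj₁ (refl , drop-∷ (↭-trans (↭-sym p) q))
... | there y∈xs with ∈-∃++ y∈xs
...   | us , vs , refl =
  inj₂ (us ++ vs , shift y us vs ,
        drop-∷ (↭-trans (↭-trans (↭-sym q) p)
                        (↭-trans (prep x (shift y us vs)) (swap x y ↭-refl))))

-- Entailment packed in a record, so that the formulas can be inferred from a proof.
infix 3 _⊨ʳ_
record _⊨ʳ_ (A B : Fm) : Set where
  constructor ent
  field entailment : A ⊨ B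

⊨ʳ-refl : ∀ {A} → A ⊨ʳ A
⊨ʳ-refl = ent λ _ h → h

⊨ʳ-trans : ∀ {A B C} → A ⊨ʳ B → B ⊨ʳ C → A ⊨ʳ C
⊨ʳ-trans (ent f) (ent g) = ent λ v h → g v (f v h)

⊥-⊨ʳ : ∀ {A} → ⊥f ⊨ʳ A
⊥-⊨ʳ = ent λ _ ()

⊨ʳ-⊤ : ∀ {A} → A ⊨ʳ ⊤f
⊨ʳ-⊤ = ent λ _ _ → refl

∧-elimˡ : ∀ {A B} → A ∧f B ⊨ʳ A
∧-elimˡ {A} {B} = ent λ v → ∧-conicalˡ (⟦ A ⟧ v) (⟦ B ⟧ v)

∧-elimʳ : ∀ {A B} → A ∧f B ⊨ʳ B
∧-elimʳ {A} {B} = ent λ v → ∧-conicalʳ (⟦ A ⟧ v) (⟦ B ⟧ v)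

∧-intro : ∀ {A B C} → A ⊨ʳ B → A ⊨ʳ C → A ⊨ʳ B ∧f C
∧-intro (ent f) (ent g) = ent λ v h → both (f v h) (g v h)
  where
  both : ∀ {b c} → b ≡ true → c ≡ true → b ∧ c ≡ true
  both refl refl = refl

∨-introˡ : ∀ {A B} → A ⊨ʳ A ∨f B
∨-introˡ = ent λ _ h → left h
  where
  left : ∀ {a b} → a ≡ true → a ∨ b ≡ true
  left refl = refl

∨-introʳ : ∀ {A B} → B ⊨ʳ A ∨f B
∨-introʳ {A} = ent λ v → right (⟦ A ⟧ v)
  where
  right : ∀ a {b} → b ≡ true → a ∨ b ≡ true
  right true  _ = refl
  right false h = h

∨-elim : ∀ {A B C} → A ⊨ʳ C → B ⊨ʳ C → A ∨f B ⊨ʳ C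
∨-elim {A} {B} {C} (ent f) (ent g) = ent λ v → cases v (⟦ A ⟧ v) refl
  where
  cases : ∀ v a → ⟦ A ⟧ v ≡ a → a ∨ ⟦ B ⟧ v ≡ true → ⟦ C ⟧ v ≡ true
  cases v true  eq _ = f v eq
  cases v false _  h = g v h

∧-mono : ∀ {B B' C} → B' ⊨ʳ B → B' ∧f C ⊨ʳ B ∧f C
∧-mono B'⊨B = ∧-intro (⊨ʳ-trans ∧-elimˡ B'⊨B) ∧-elimʳ

∨-mono : ∀ {Y Y' C} → Y ⊨ʳ Y' → Y ∨f C ⊨ʳ Y' ∨f C
∨-mono Y⊨Y' = ∨-elim (⊨ʳ-trans Y⊨Y' ∨-introˡ) ∨-introʳ

∧-swapʳ : ∀ {P Q R} → (P ∧f Q) ∧f R ⊨ʳ (P ∧f R) ∧f Q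
∧-swapʳ = ∧-intro (∧-mono ∧-elimˡ) (⊨ʳ-trans ∧-elimˡ ∧-elimʳ)

∨-swapʳ : ∀ {P Q R} → (P ∨f Q) ∨f R ⊨ʳ (P ∨f R) ∨f Q
∨-swapʳ = ∨-elim (∨-elim (⊨ʳ-trans ∨-introˡ ∨-introˡ) ∨-introʳ)
                 (⊨ʳ-trans ∨-introʳ ∨-introˡ)

excluded-middle : ∀ {X} → ⊤f ⊨ʳ X ∨f ¬f X
excluded-middle {X} = ent λ v _ → table (⟦ X ⟧ v)
  where
  table : ∀ x → x ∨ not x ≡ true
  table true  = refl
  table false = refl

non-contradiction : ∀ {A} → A ∧f ¬f A ⊨ʳ ⊥f
non-contradiction {A} = ent λ v → table (⟦ A ⟧ v)
  where
  table : ∀ a → a ∧ not a ≡ true → false ≡ true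
  table true  ()
  table false ()

case-split : ∀ {B A} → B ⊨ʳ (B ∧f ¬f A) ∨f (B ∧f A)
case-split {B} {A} = ent λ v → table (⟦ B ⟧ v) (⟦ A ⟧ v)
  where
  table : ∀ b a → b ≡ true → (b ∧ not a) ∨ (b ∧ a) ≡ true
  table true  true  _ = refl
  table true  false _ = refl
  table false _     ()

disjunctive-syllogism : ∀ {Y X} → (Y ∨f ¬f X) ∧f X ⊨ʳ Y
disjunctive-syllogism {Y} {X} = ent λ v → table (⟦ Y ⟧ v) (⟦ X ⟧ v)
  where
  table : ∀ y x → (y ∨ not x) ∧ x ≡ true → y ≡ true
  table true  _     _  = refl
  table false true  ()
  table false false ()

∧-distribʳ-∨ : ∀ {A₁ A₂ C} → (A₁ ∨f A₂) ∧f C ⊨ʳ (A₁ ∧f C) ∨f (A₂ ∧f C)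
∧-distribʳ-∨ {A₁} {A₂} {C} = ent λ v → table (⟦ A₁ ⟧ v) (⟦ A₂ ⟧ v) (⟦ C ⟧ v)
  where
  table : ∀ a₁ a₂ c → (a₁ ∨ a₂) ∧ c ≡ true → (a₁ ∧ c) ∨ (a₂ ∧ c) ≡ true
  table true  _     true  _  = refl
  table false true  true  _  = refl
  table false false true  ()
  table true  _     false ()
  table false true  false ()
  table false false false ()

∨-factorʳ-∧ : ∀ {X₁ X₂ X} → (X₁ ∨f ¬f X) ∧f (X₂ ∨f ¬f X) ⊨ʳ (X₁ ∧f X₂) ∨f ¬f X
∨-factorʳ-∧ {X₁} {X₂} {X} = ent λ v → table (⟦ X₁ ⟧ v) (⟦ X₂ ⟧ v) (⟦ X ⟧ v)
  where
  table : ∀ x₁ x₂ x → (x₁ ∨ not x) ∧ (x₂ ∨ not x) ≡ true →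
          (x₁ ∧ x₂) ∨ not x ≡ true
  table true  true  true  _  = refl
  table true  false true  ()
  table false _     true  ()
  table x₁    x₂    false _  = ∨-zeroʳ (x₁ ∧ x₂)

∧-∨¬-resolve : ∀ {A X X'} → (A ∧f X') ∧f (X ∨f ¬f X') ⊨ʳ (A ∧f X) ∧f X'
∧-∨¬-resolve =
  ∧-intro (∧-intro (⊨ʳ-trans ∧-elimˡ ∧-elimˡ)
                   (⊨ʳ-trans (∧-intro ∧-elimʳ (⊨ʳ-trans ∧-elimˡ ∧-elimʳ))
                             disjunctive-syllogism))
          (⊨ʳ-trans ∧-elimˡ ∧-elimʳ)

WOʳ : ∀ {G A X Y} → G ⊢OUT4⁺ (A , X) → X ⊨ʳ Y → G ⊢OUT4⁺ (A , Y)
WOʳ d (ent X⊨Y) = WO d X⊨Y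

SIʳ : ∀ {G A B X} → G ⊢OUT4⁺ (A , X) → B ⊨ʳ A → G ⊢OUT4⁺ (B , X)
SIʳ d (ent B⊨A) = SI d B⊨A

OUT4⁺-weaken : ∀ {G G' p} → G ⊆ G' → G ⊢OUT4⁺ p → G' ⊢OUT4⁺ p
OUT4⁺-weaken G⊆G' (leaf p∈G) = leaf (G⊆G' p∈G)
OUT4⁺-weaken G⊆G' TOP        = TOP
OUT4⁺-weaken G⊆G' BOT        = BOT
OUT4⁺-weaken G⊆G' (WO d X⊨Y) = WO (OUT4⁺-weaken G⊆G' d) X⊨Y
OUT4⁺-weaken G⊆G' (SI d B⊨A) = SI (OUT4⁺-weaken G⊆G' d) B⊨A
OUT4⁺-weaken G⊆G' (AND d e)  = AND (OUT4⁺-weaken G⊆G' d) (OUT4⁺-weaken G⊆G' e)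
OUT4⁺-weaken G⊆G' (OR d e)   = OR (OUT4⁺-weaken G⊆G' d) (OUT4⁺-weaken G⊆G' e)
OUT4⁺-weaken G⊆G' (CT d e)   = CT (OUT4⁺-weaken G⊆G' d) (OUT4⁺-weaken G⊆G' e)

E4-derivable : ∀ {G A X B Y} → (A , X) ∈ G →
               G ⊢OUT4⁺ (B ∧f ¬f A , Y) → G ⊢OUT4⁺ (B ∧f X , Y ∨f ¬f X) →
               G ⊢OUT4⁺ (B , Y)
E4-derivable AX∈G d¬A dX =
  SIʳ (OR d¬A (WOʳ (AND (CT dA (SIʳ dX (∧-mono ∧-elimˡ))) dA)
                   disjunctive-syllogism))
      case-split
  where
  dA = SIʳ (leaf AX∈G) ∧-elimʳ

C4⇒OUT4⁺ : ∀ {G B Y} → C4 G (B , Y) → G ⊢OUT4⁺ (B , Y)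
C4⇒OUT4⁺ (IN B⊨⊥)  = SI (WOʳ BOT ⊥-⊨ʳ) B⊨⊥
C4⇒OUT4⁺ (OUT ⊤⊨Y) = SIʳ (WO TOP ⊤⊨Y) ⊨ʳ-⊤
C4⇒OUT4⁺ {G} (E4 {G₀} d¬A dX G↭AXG₀) =
  E4-derivable (∈-resp-↭ (↭-sym G↭AXG₀) (here refl))
               (OUT4⁺-weaken G₀⊆G (C4⇒OUT4⁺ d¬A))
               (OUT4⁺-weaken G₀⊆G (C4⇒OUT4⁺ dX))
  where
  G₀⊆G : G₀ ⊆ G
  G₀⊆G p∈G₀ = ∈-resp-↭ (↭-sym G↭AXG₀) (there p∈G₀)

INʳ : ∀ {G B Y} → B ⊨ʳ ⊥f → C4 G (B , Y)
INʳ (ent B⊨⊥) = IN B⊨⊥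

OUTʳ : ∀ {G B Y} → ⊤f ⊨ʳ Y → C4 G (B , Y)
OUTʳ (ent ⊤⊨Y) = OUT ⊤⊨Y

C4-↭ : ∀ {G G' p} → C4 G p → G ↭ G' → C4 G' p
C4-↭ (IN B⊨⊥)      _    = IN B⊨⊥
C4-↭ (OUT ⊤⊨Y)     _    = OUT ⊤⊨Y
C4-↭ (E4 d¬A dX π) G↭G' = E4 d¬A dX (↭-trans (↭-sym G↭G') π)

C4-mono : ∀ {G B Y B' Y'} → C4 G (B , Y) → B' ⊨ʳ B → Y ⊨ʳ Y' → C4 G (B' , Y')
C4-mono (IN B⊨⊥)      B'⊨B _    = INʳ (⊨ʳ-trans B'⊨B (ent B⊨⊥))
C4-mono (OUT ⊤⊨Y)     _    Y⊨Y' = OUTʳ (⊨ʳ-trans (ent ⊤⊨Y) Y⊨Y')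
C4-mono (E4 d¬A dX π) B'⊨B Y⊨Y' =
  E4 (C4-mono d¬A (∧-mono B'⊨B) Y⊨Y') (C4-mono dX (∧-mono B'⊨B) (∨-mono Y⊨Y')) π

E4-inversion : ∀ {G G' A X B Y} → C4 G' (B , Y) → G' ↭ (A , X) ∷ G →
               C4 G (B ∧f ¬f A , Y) × C4 G (B ∧f X , Y ∨f ¬f X)
E4-inversion (IN B⊨⊥) _ =
  C4-mono (IN B⊨⊥) ∧-elimˡ ⊨ʳ-refl , C4-mono (IN B⊨⊥) ∧-elimˡ ⊨ʳ-refl
E4-inversion (OUT ⊤⊨Y) _ =
  C4-mono (OUT ⊤⊨Y) ⊨ʳ-refl ⊨ʳ-refl , C4-mono (OUT ⊤⊨Y) ⊨ʳ-refl ∨-introˡ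
E4-inversion (E4 d¬A dX π) ρ with ↭-∷-cases π ρ
... | inj₁ (refl , σ) = C4-↭ d¬A σ , C4-↭ dX σ
-- E4 steps on two different pairs of G commute.
... | inj₂ (_ , σ , τ) =
  let d¬A¬A' , d¬AX' = E4-inversion d¬A σ
      dX¬A'  , dXX'  = E4-inversion dX σ
  in E4 (C4-mono d¬A¬A' ∧-swapʳ ⊨ʳ-refl) (C4-mono dX¬A' ∧-swapʳ ⊨ʳ-refl) τ
   , E4 (C4-mono d¬AX'  ∧-swapʳ ⊨ʳ-refl) (C4-mono dXX'  ∧-swapʳ ∨-swapʳ) τ

C4-∈ : ∀ {G A X} → (A , X) ∈ G → C4 G (A , X)
C4-∈ AX∈G with ∈-∃++ AX∈G
... | us , vs , refl =
  E4 (INʳ non-contradiction) (OUTʳ excluded-middle) (shift _ us vs)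

C4-AND : ∀ {G A X₁ X₂} → C4 G (A , X₁) → C4 G (A , X₂) → C4 G (A , X₁ ∧f X₂)
C4-AND (IN A⊨⊥)   _  = IN A⊨⊥
C4-AND (OUT ⊤⊨X₁) d₂ =
  C4-mono d₂ ⊨ʳ-refl (∧-intro (⊨ʳ-trans ⊨ʳ-⊤ (ent ⊤⊨X₁)) ⊨ʳ-refl)
C4-AND (E4 d¬A dX π) d₂ =
  let d₂¬A , d₂X = E4-inversion d₂ π
  in E4 (C4-AND d¬A d₂¬A) (C4-mono (C4-AND dX d₂X) ⊨ʳ-refl ∨-factorʳ-∧) π

C4-OR : ∀ {G A₁ A₂ X} → C4 G (A₁ , X) → C4 G (A₂ , X) → C4 G (A₁ ∨f A₂ , X)
C4-OR (IN A₁⊨⊥) d₂ =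
  C4-mono d₂ (∨-elim (⊨ʳ-trans (ent A₁⊨⊥) ⊥-⊨ʳ) ⊨ʳ-refl) ⊨ʳ-refl
C4-OR (OUT ⊤⊨X) _ = OUT ⊤⊨X
C4-OR (E4 d¬A dX π) d₂ =
  let d₂¬A , d₂X = E4-inversion d₂ π
  in E4 (C4-mono (C4-OR d¬A d₂¬A) ∧-distribʳ-∨ ⊨ʳ-refl)
        (C4-mono (C4-OR dX d₂X) ∧-distribʳ-∨ ⊨ʳ-refl) π

C4-CT : ∀ {G A X Y} → C4 G (A , X) → C4 G (A ∧f X , Y) → C4 G (A , Y)
C4-CT (IN A⊨⊥)  _  = IN A⊨⊥
C4-CT (OUT ⊤⊨X) d₂ =
  C4-mono d₂ (∧-intro ⊨ʳ-refl (⊨ʳ-trans ⊨ʳ-⊤ (ent ⊤⊨X))) ⊨ʳ-refl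
C4-CT (E4 d¬A dX π) d₂ =
  let d₂¬A , d₂X = E4-inversion d₂ π
  in E4 (C4-CT d¬A (C4-mono d₂¬A ∧-swapʳ ⊨ʳ-refl))
        (C4-CT dX (C4-mono d₂X ∧-∨¬-resolve ⊨ʳ-refl)) π

OUT4⁺⇒C4 : ∀ {G B Y} → G ⊢OUT4⁺ (B , Y) → C4 G (B , Y)
OUT4⁺⇒C4 (leaf BY∈G) = C4-∈ BY∈G
OUT4⁺⇒C4 TOP         = OUT λ _ h → h
OUT4⁺⇒C4 BOT         = IN λ _ h → h
OUT4⁺⇒C4 (WO d X⊨Y)  = C4-mono (OUT4⁺⇒C4 d) ⊨ʳ-refl (ent X⊨Y)
OUT4⁺⇒C4 (SI d B⊨A)  = C4-mono (OUT4⁺⇒C4 d) (ent B⊨A) ⊨ʳ-refl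
OUT4⁺⇒C4 (AND d₁ d₂) = C4-AND (OUT4⁺⇒C4 d₁) (OUT4⁺⇒C4 d₂)
OUT4⁺⇒C4 (OR d₁ d₂)  = C4-OR (OUT4⁺⇒C4 d₁) (OUT4⁺⇒C4 d₂)
OUT4⁺⇒C4 (CT d₁ d₂)  = C4-CT (OUT4⁺⇒C4 d₁) (OUT4⁺⇒C4 d₂)

theorem2 : (G : List Pair) (B Y : Fm) → C4 G (B , Y) ⇔ (G ⊢OUT4⁺ (B , Y))
theorem2 G B Y = mk⇔ C4⇒OUT4⁺ OUT4⁺⇒C4
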